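{- Let $r,s,k,t$ be positive integers such that $r=sk+t$ and $r,s,t\geq 3$. Let $S_1$ be a double-star of size $s$ and $S_2$ be a double-star of size $t$. Then every (finite, simple) $r$-regular bipartite graph $G$ is $\{S_1,S_2\}$-decomposable.
   Context: A double-star is a tree with exactly two non-pendant vertices (a pendant vertex being a vertex of degree $1$); the size of a graph is its number of edges. A graph $G$ is $\{H_1,\ldots,H_m\}$-decomposable if $E(G)$ can be partitioned into subsets each of which forms a subgraph isomorphic to some $H_i$, $1\le i\le m$. -}

module Defs where

open import Data.Nat using (ℕ; _+_; _*_)
open import Data.Bool using (Bool; true; false; if_then_else_)
open import Data.Fin using (Fin; toℕ)
open import Data.Fin.Properties using (_<?_)
open import Data.List using (List; allFin; map; filter; length)
open import Data.Nat.ListAction using (sum)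
open import Data.Product using (Σ; _×_; ∃)
open import Data.Sum using (_⊎_)
open import Relation.Binary.PropositionalEquality using (_≡_; _≢_)
open import Relation.Nullary using (¬_; Dec)
open import Relation.Nullary.Decidable using (yes; no)
open import Data.Nat.Properties using (_≟_)
open import Function using (_⇔_)
open import Function.Definitions using (Injective)

record Graph (n : ℕ) : Set where
  field
    Adj   : Fin n → Fin n → Bool
    sym   : ∀ u v → Adj u v ≡ Adj v u
    irrefl : ∀ v → Adj v v ≡ false
open Graph public

degree : ∀ {n} → Graph n → Fin n → ℕ
degree G v = sum (map (λ u → if Adj G v u then 1 else 0) (allFin _))

size : ∀ {n} → Graph n → ℕ
size {n} G = sum (map (λ u → sum (map (λ v → count u v) (allFin n))) (allFin n))
  where
  count : Fin n → Fin n → ℕ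
  count u v with u <? v
  ... | yes _ = if Adj G u v then 1 else 0
  ... | no  _ = 0

data Reachable {n} (G : Graph n) : Fin n → Fin n → Set where
  here : ∀ {u} → Reachable G u u
  step : ∀ {u v w} → Adj G u v ≡ true → Reachable G v w → Reachable G u w

Connected : ∀ {n} → Graph n → Set
Connected G = ∀ u v → Reachable G u v

IsTree : ∀ {n} → Graph n → Set
IsTree {n} G = Connected G × n ≡ size G + 1

nonPendantCount : ∀ {n} → Graph n → ℕ
nonPendantCount G = length (filter (λ v → Relation.Nullary.¬? (degree G v ≟ 1)) (allFin _))

IsDoubleStar : ∀ {n} → Graph n → Set
IsDoubleStar G = IsTree G × nonPendantCount G ≡ 2

Regular : ∀ {n} → ℕ → Graph n → Set
Regular r G = ∀ v → degree G v ≡ r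

Bipartite : ∀ {n} → Graph n → Set
Bipartite {n} G = Σ (Fin n → Bool) λ c → ∀ u v → Adj G u v ≡ true → c u ≢ c v

-- Given an edge labelling lab of G, the subgraph formed by the edges with
-- label i is isomorphic to H (H has no isolated vertices in our use, so the
-- subgraph formed by an edge set has exactly the endpoints as vertices).
ClassIso : ∀ {n m p} → Graph n → (Fin n → Fin n → Fin m) → Fin m → Graph p → Set
ClassIso {n} {m} {p} G lab i H =
  Σ (Fin p → Fin n) λ f →
    Injective _≡_ _≡_ f
    × (∀ a b → (Adj H a b ≡ true) ⇔ (Adj G (f a) (f b) ≡ true × lab (f a) (f b) ≡ i))
    × (∀ u v → Adj G u v ≡ true → lab u v ≡ i → (∃ λ a → f a ≡ u) × (∃ λ b → f b ≡ v))

Decomposable₂ : ∀ {n p q} → Graph n → Graph p → Graph q → Set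
Decomposable₂ {n} G H₁ H₂ =
  Σ ℕ λ m → Σ (Fin n → Fin n → Fin m) λ lab →
    (∀ u v → Adj G u v ≡ true → lab u v ≡ lab v u)
    × (∀ i → ClassIso G lab i H₁ ⊎ ClassIso G lab i H₂)

-- Colour the edges of the r-regular bipartite graph G properly with r colours (Kőnig's theorem,
-- proved by Kempe-chain swaps), so every vertex meets each colour exactly once. Split the colours
-- into k blocks of s = 1 + a₁ + b₁ colours and one block of t = 1 + a₂ + b₂, where the double-star
-- with centres c₁ c₂ has a leaves at c₁ and b at c₂, and match the colours of a block with the
-- edges of its double-star. For a block and a vertex w on side A, let w₂ be the neighbour of w in
-- the centre colour; the edge w w₂, the edges at w in the colours of the leaves of c₁ and the edges
-- at w₂ in the colours of the leaves of c₂ form a copy of the double-star. Properness makes each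
-- copy a tree of the right shape, and every edge x y of the block with x ∈ A lies in exactly one
-- copy, the one at x or at the centre-colour neighbour of y. Labelling edges by (block, w) gives
-- the decomposition.

module Submission where

open import Axiom.UniquenessOfIdentityProofs using (module Decidable⇒UIP)
open import Data.Bool using (Bool; true; false; if_then_else_; not; _∧_; _∨_)
open import Data.Bool.Properties using (not-involutive; not-injective; not-¬; ¬-not; ∧-conicalˡ; ∧-conicalʳ)
  renaming (_≟_ to _≟ᵇ_)
open import Data.Empty using (⊥; ⊥-elim)
open import Data.Fin using (Fin; zero; suc; toℕ; fromℕ<; punchOut; _↑ˡ_; _↑ʳ_; splitAt; combine; remQuot)
open import Data.Fin.Properties
  using (_≟_; suc-injective; any?; all?; pigeonhole; toℕ<n; toℕ-fromℕ<; <⇒notInjective; injective⇒≤;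
         punchOut-injective; splitAt-↑ˡ; splitAt-↑ʳ; splitAt⁻¹-↑ˡ; splitAt⁻¹-↑ʳ; combine-injective;
         combine-remQuot)
open import Data.List as List using (List; []; _∷_; allFin; cartesianProduct)
open import Data.List.Membership.Propositional using (_∈_)
open import Data.List.Membership.Propositional.Properties using (∈-allFin; ∈-cartesianProduct⁺)
open import Data.List.Relation.Unary.Any as Any using ()
open import Data.Maybe using (Maybe; just; nothing; is-just; map; fromMaybe; _>>=_)
open import Data.Maybe.Properties using (just-injective; ≡-dec)
open import Data.Nat as ℕ using (ℕ; zero; suc; _+_; _*_; _∸_; _≤_; _<_; z≤n; s≤s; s≤s⁻¹)
open import Data.Nat.ListAction using (sum)
open import Data.Nat.Properties
  using (≤-refl; +-mono-≤; +-mono-≤-<; +-comm; *-comm; n<1+n; m∸n+n≡m; <-≤-connex; <-irrefl;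
         +-commutativeSemigroup)
open import Algebra.Properties.CommutativeSemigroup +-commutativeSemigroup using (interchange)
open import Data.Product using (Σ; ∃; _×_; _,_; proj₁; proj₂; map₂)
open import Data.Product.Properties using (,-injectiveʳ-UIP)
open import Data.Sum using (_⊎_; inj₁; inj₂; [_,_]′)
open import Function using (_∘_)
open import Function.Bundles using (mk⇔)
open import Relation.Binary.PropositionalEquality
open import Relation.Nullary using (Dec; yes; no; ¬_; ¬?)
open import Relation.Nullary.Decidable using (does; dec-true; dec-false; _×-dec_; _⊎-dec_)
open import Relation.Unary using (Decidable)

open import Defs
  using (Graph; Adj; degree; size; Reachable; here; step; Connected; IsTree; IsDoubleStar;
         Regular; Bipartite; ClassIso; Decomposable₂)

-- Counting and enumerating subsets of Fin n

indicator : Bool → ℕ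
indicator b = if b then 1 else 0

count : ∀ {n} → (Fin n → Bool) → ℕ
count {zero}  P = 0
count {suc n} P = indicator (P zero) + count (P ∘ suc)

mutual
  enum : ∀ {n} (P : Fin n → Bool) → Fin (count P) → Fin n
  enum {suc n} P = enumFrom (P zero) (P ∘ suc)

  enumFrom : ∀ {n} (b : Bool) (Q : Fin n → Bool) → Fin (indicator b + count Q) → Fin (suc n)
  enumFrom true  Q zero    = zero
  enumFrom true  Q (suc i) = suc (enum Q i)
  enumFrom false Q i       = suc (enum Q i)

rankHead : ∀ {n} b (Q : Fin n → Bool) → b ≡ true → Fin (indicator b + count Q)
rankHead true Q _ = zero

rankTail : ∀ {n} b (Q : Fin n → Bool) → Fin (count Q) → Fin (indicator b + count Q)
rankTail true  Q i = suc i
rankTail false Q i = i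

rank : ∀ {n} (P : Fin n → Bool) x → P x ≡ true → Fin (count P)
rank {suc n} P zero    px = rankHead (P zero) (P ∘ suc) px
rank {suc n} P (suc x) px = rankTail (P zero) (P ∘ suc) (rank (P ∘ suc) x px)

enum-rank : ∀ {n} (P : Fin n → Bool) x (px : P x ≡ true) → enum P (rank P x px) ≡ x
enum-rank {suc n} P zero    px = head (P zero) px
  where
  head : ∀ b (pb : b ≡ true) → enumFrom b (P ∘ suc) (rankHead b (P ∘ suc) pb) ≡ zero
  head true _ = refl
enum-rank {suc n} P (suc x) px = tail (P zero) (rank (P ∘ suc) x px) (enum-rank (P ∘ suc) x px)
  where
  tail : ∀ b i → enum (P ∘ suc) i ≡ x → enumFrom b (P ∘ suc) (rankTail b (P ∘ suc) i) ≡ suc x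
  tail true  i eq = cong suc eq
  tail false i eq = cong suc eq

enum-true : ∀ {n} (P : Fin n → Bool) i → P (enum P i) ≡ true
enum-true {suc n} P = enumFrom-true (P zero) refl
  where
  enumFrom-true : ∀ b → P zero ≡ b → ∀ i → P (enumFrom b (P ∘ suc) i) ≡ true
  enumFrom-true true  eq zero    = eq
  enumFrom-true true  eq (suc i) = enum-true (P ∘ suc) i
  enumFrom-true false eq i       = enum-true (P ∘ suc) i

mutual
  enum-injective : ∀ {n} (P : Fin n → Bool) i j → enum P i ≡ enum P j → i ≡ j
  enum-injective {suc n} P = enumFrom-injective (P zero) (P ∘ suc)

  enumFrom-injective : ∀ {n} b (Q : Fin n → Bool) i j → enumFrom b Q i ≡ enumFrom b Q j → i ≡ j
  enumFrom-injective true  Q zero    zero    _  = refl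
  enumFrom-injective true  Q (suc i) (suc j) eq = cong suc (enum-injective Q i j (suc-injective eq))
  enumFrom-injective false Q i       j       eq = enum-injective Q i j (suc-injective eq)

rank-enum : ∀ {n} (P : Fin n → Bool) i (p : P (enum P i) ≡ true) → rank P (enum P i) p ≡ i
rank-enum P i p = enum-injective P _ _ (enum-rank P (enum P i) p)

rank-injective : ∀ {n} (P : Fin n → Bool) x y (p : P x ≡ true) (q : P y ≡ true) →
                 rank P x p ≡ rank P y q → x ≡ y
rank-injective P x y p q eq = trans (sym (enum-rank P x p)) (trans (cong (enum P) eq) (enum-rank P y q))

count-cong : ∀ {n} (P Q : Fin n → Bool) → (∀ x → P x ≡ Q x) → count P ≡ count Q
count-cong {zero}  P Q eq = refl
count-cong {suc n} P Q eq = cong₂ _+_ (cong indicator (eq zero)) (count-cong _ _ (eq ∘ suc))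

count-true : ∀ n → count {n} (λ _ → true) ≡ n
count-true zero    = refl
count-true (suc n) = cong suc (count-true n)

count-false : ∀ n → count {n} (λ _ → false) ≡ 0
count-false zero    = refl
count-false (suc n) = count-false n

indicator-mono : ∀ {a b} → (a ≡ true → b ≡ true) → indicator a ≤ indicator b
indicator-mono {false} _ = z≤n
indicator-mono {true}  a⇒b rewrite a⇒b refl = ≤-refl

count-mono : ∀ {n} (P Q : Fin n → Bool) → (∀ x → P x ≡ true → Q x ≡ true) → count P ≤ count Q
count-mono {zero}  P Q P⊆Q = z≤n
count-mono {suc n} P Q P⊆Q = +-mono-≤ (indicator-mono (P⊆Q zero)) (count-mono _ _ (P⊆Q ∘ suc))

count-mono-< : ∀ {n} (P Q : Fin n → Bool) → (∀ x → P x ≡ true → Q x ≡ true) →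
               ∀ w → P w ≡ false → Q w ≡ true → count P < count Q
count-mono-< {suc n} P Q P⊆Q zero    pw qw rewrite pw | qw = s≤s (count-mono _ _ (P⊆Q ∘ suc))
count-mono-< {suc n} P Q P⊆Q (suc w) pw qw =
  +-mono-≤-< (indicator-mono (P⊆Q zero)) (count-mono-< _ _ (P⊆Q ∘ suc) w pw qw)

count-∨ : ∀ {n} (P Q : Fin n → Bool) → (∀ x → P x ≡ true → Q x ≡ true → ⊥) →
          count (λ x → P x ∨ Q x) ≡ count P + count Q
count-∨ {zero}  P Q disjoint = refl
count-∨ {suc n} P Q disjoint = begin
    indicator (P zero ∨ Q zero) + count (λ x → P (suc x) ∨ Q (suc x))
  ≡⟨ cong₂ _+_ (indicator-∨ (P zero) (Q zero) (disjoint zero)) (count-∨ _ _ (disjoint ∘ suc)) ⟩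
    (indicator (P zero) + indicator (Q zero)) + (count (P ∘ suc) + count (Q ∘ suc))
  ≡⟨ interchange (indicator (P zero)) _ _ _ ⟩
    (indicator (P zero) + count (P ∘ suc)) + (indicator (Q zero) + count (Q ∘ suc))
  ∎
  where
  open ≡-Reasoning
  indicator-∨ : ∀ a b → (a ≡ true → b ≡ true → ⊥) → indicator (a ∨ b) ≡ indicator a + indicator b
  indicator-∨ false b     _    = refl
  indicator-∨ true  false _    = refl
  indicator-∨ true  true  both = ⊥-elim (both refl refl)

count≡1⇒unique : ∀ {n} (P : Fin n → Bool) → count P ≡ 1 → ∀ x y → P x ≡ true → P y ≡ true → x ≡ y
count≡1⇒unique P one x y px py = rank-injective P x y px py (Fin1-unique (rank P x px) (rank P y py))
  where
  Fin1-unique : (i j : Fin (count P)) → i ≡ j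
  Fin1-unique i j rewrite one with i | j
  ... | zero | zero = refl

count≡2⇒pair : ∀ {n} (P : Fin n → Bool) → count P ≡ 2 →
               Σ (Fin n) λ x → Σ (Fin n) λ y →
                 x ≢ y × P x ≡ true × P y ≡ true × (∀ z → P z ≡ true → z ≡ x ⊎ z ≡ y)
count≡2⇒pair P two = enum P (toP zero) , enum P (toP (suc zero)) , distinct , enum-true P _ , enum-true P _ , onlyTwo
  where
  toP : Fin 2 → Fin (count P)
  toP = subst Fin (sym two)
  fromP : Fin (count P) → Fin 2
  fromP = subst Fin two
  distinct : enum P (toP zero) ≢ enum P (toP (suc zero))
  distinct eq with trans (sym (subst-subst-sym two)) (trans (cong fromP (enum-injective P _ _ eq)) (subst-subst-sym two))
  ... | ()
  onlyTwo : ∀ z → P z ≡ true → z ≡ enum P (toP zero) ⊎ z ≡ enum P (toP (suc zero))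
  onlyTwo z pz with fromP (rank P z pz) in eq
  ... | zero     = inj₁ (trans (sym (enum-rank P z pz)) (cong (enum P) (trans (sym (subst-sym-subst two)) (cong toP eq))))
  ... | suc zero = inj₂ (trans (sym (enum-rank P z pz)) (cong (enum P) (trans (sym (subst-sym-subst two)) (cong toP eq))))

sum-indicator≡count : ∀ {n} {A : Set} (f : Fin n → A) (P : A → Bool) →
                      sum (List.map (λ x → if P x then 1 else 0) (List.tabulate f)) ≡ count (P ∘ f)
sum-indicator≡count {zero}  f P = refl
sum-indicator≡count {suc n} f P = cong (indicator (P (f zero)) +_) (sum-indicator≡count (f ∘ suc) P)

length-filter≡count : ∀ {n} {A : Set} (f : Fin n → A) {Q : A → Set} (Q? : Decidable Q) →
                      List.length (List.filter Q? (List.tabulate f)) ≡ count (λ x → does (Q? (f x)))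
length-filter≡count {zero}  f Q? = refl
length-filter≡count {suc n} f Q? with does (Q? (f zero))
... | true  = cong suc (length-filter≡count (f ∘ suc) Q?)
... | false = length-filter≡count (f ∘ suc) Q?

degree≡count : ∀ {n} (G : Graph n) v → degree G v ≡ count (Adj G v)
degree≡count G v = sum-indicator≡count (λ x → x) (Adj G v)

-- Kőnig's edge-colouring theorem for regular bipartite graphs

adj-sym : ∀ {n} (G : Graph n) {x y} → Adj G x y ≡ true → Adj G y x ≡ true
adj-sym G {x} {y} xy = trans (Graph.sym G y x) xy

adj⇒≢ : ∀ {n} (G : Graph n) {x y} → Adj G x y ≡ true → x ≢ y
adj⇒≢ G {x} xy refl with trans (sym xy) (Graph.irrefl G x)
... | ()

module _ {n r : ℕ} (G : Graph n) where

  record PartialColouring : Set where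
    field
      colour     : Fin n → Fin n → Maybe (Fin r)
      colour⇒adj : ∀ {x y α} → colour x y ≡ just α → Adj G x y ≡ true
      colour-sym : ∀ x y → colour x y ≡ colour y x
      proper     : ∀ {x y z α} → colour x y ≡ just α → colour x z ≡ just α → y ≡ z
  open PartialColouring

  Misses : PartialColouring → Fin n → Fin r → Set
  Misses P x α = ∀ y → colour P x y ≢ just α

  _⊑_ : PartialColouring → PartialColouring → Set
  P ⊑ Q = ∀ {x y α} → colour P x y ≡ just α → ∃ λ β → colour Q x y ≡ just β

  ⊑-refl : ∀ {P} → P ⊑ P
  ⊑-refl c = _ , c

  ⊑-trans : ∀ {P Q R} → P ⊑ Q → Q ⊑ R → P ⊑ R
  ⊑-trans P⊑Q Q⊑R c = Q⊑R (proj₂ (P⊑Q c))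

  emptyColouring : PartialColouring
  emptyColouring = record
    { colour = λ _ _ → nothing ; colour⇒adj = λ () ; colour-sym = λ _ _ → refl ; proper = λ () }

  IsPair : Fin n → Fin n → Fin n → Fin n → Set
  IsPair u v x y = (x ≡ u × y ≡ v) ⊎ (x ≡ v × y ≡ u)

  isPair? : ∀ u v x y → Dec (IsPair u v x y)
  isPair? u v x y = (x ≟ u ×-dec y ≟ v) ⊎-dec (x ≟ v ×-dec y ≟ u)

  IsPair-sym : ∀ {u v x y} → IsPair u v x y → IsPair u v y x
  IsPair-sym (inj₁ (x≡u , y≡v)) = inj₂ (y≡v , x≡u)
  IsPair-sym (inj₂ (x≡v , y≡u)) = inj₁ (y≡u , x≡v)

  colourEdge : (P : PartialColouring) {u v : Fin n} (α : Fin r) → Adj G u v ≡ true →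
               Misses P u α → Misses P v α → Σ PartialColouring λ Q → P ⊑ Q × colour Q u v ≡ just α
  colourEdge P {u} {v} α uv u-misses v-misses = Q , extends , coloured
    where
    colour′ : Fin n → Fin n → Maybe (Fin r)
    colour′ x y with isPair? u v x y
    ... | yes _ = just α
    ... | no _  = colour P x y

    adj′ : ∀ {x y β} → colour′ x y ≡ just β → Adj G x y ≡ true
    adj′ {x} {y} c with isPair? u v x y
    ... | yes (inj₁ (refl , refl)) = uv
    ... | yes (inj₂ (refl , refl)) = adj-sym G uv
    ... | no _ = colour⇒adj P c

    sym′ : ∀ x y → colour′ x y ≡ colour′ y x
    sym′ x y with isPair? u v x y | isPair? u v y x
    ... | yes _ | yes _ = refl
    ... | no _  | no _  = colour-sym P x y
    ... | yes p | no ¬p = ⊥-elim (¬p (IsPair-sym p))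
    ... | no ¬p | yes p = ⊥-elim (¬p (IsPair-sym p))

    endpoint-misses : ∀ {x y} → IsPair u v x y → Misses P x α
    endpoint-misses (inj₁ (refl , _)) = u-misses
    endpoint-misses (inj₂ (refl , _)) = v-misses

    proper′ : ∀ {x y z β} → colour′ x y ≡ just β → colour′ x z ≡ just β → y ≡ z
    proper′ {x} {y} {z} cy cz with isPair? u v x y | isPair? u v x z
    ... | no _ | no _ = proper P {x} cy cz
    ... | yes p | no _ = ⊥-elim (endpoint-misses p z (trans cz (sym cy)))
    ... | no _ | yes p = ⊥-elim (endpoint-misses p y (trans cy (sym cz)))
    ... | yes (inj₁ (_ , refl)) | yes (inj₁ (_ , refl)) = refl
    ... | yes (inj₂ (_ , refl)) | yes (inj₂ (_ , refl)) = refl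
    ... | yes (inj₁ (refl , _)) | yes (inj₂ (u≡v , _)) = ⊥-elim (adj⇒≢ G uv u≡v)
    ... | yes (inj₂ (refl , _)) | yes (inj₁ (v≡u , _)) = ⊥-elim (adj⇒≢ G uv (sym v≡u))

    Q : PartialColouring
    Q = record { colour = colour′ ; colour⇒adj = adj′ ; colour-sym = sym′ ; proper = λ {x} → proper′ {x} }

    extends : P ⊑ Q
    extends {x} {y} c with isPair? u v x y
    ... | yes _ = α , refl
    ... | no _  = _ , c

    coloured : colour′ u v ≡ just α
    coloured with isPair? u v u v
    ... | yes _ = refl
    ... | no ¬p = ⊥-elim (¬p (inj₁ (refl , refl)))

  _≟ᴹ_ : ∀ {m} (a b : Maybe (Fin m)) → Dec (a ≡ b)
  _≟ᴹ_ = ≡-dec _≟_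

  missingColour : Regular r G → (P : PartialColouring) {u v : Fin n} →
                  Adj G u v ≡ true → colour P u v ≡ nothing → ∃ (Misses P u)
  missingColour regular P {u} {v} uv uncoloured
    with any? (λ α → all? (λ y → ¬? (colour P u y ≟ᴹ just α)))
  ... | yes found = found
  ... | no none = ⊥-elim (<⇒notInjective fewer neighbourRank-injective)
    where
    -- Otherwise the r colours would occur on distinct edges at u, but uv is not one of them.
    neighbourOf : ∀ α → ∃ λ y → colour P u y ≡ just α
    neighbourOf α with any? (λ y → colour P u y ≟ᴹ just α)
    ... | yes found = found
    ... | no absent = ⊥-elim (none (α , λ y c → absent (y , c)))
    Used : Fin n → Bool
    Used y = is-just (colour P u y)
    used : ∀ α → Used (proj₁ (neighbourOf α)) ≡ true
    used α rewrite proj₂ (neighbourOf α) = refl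
    neighbourRank : Fin r → Fin (count Used)
    neighbourRank α = rank Used _ (used α)
    neighbourRank-injective : ∀ {α β} → neighbourRank α ≡ neighbourRank β → α ≡ β
    neighbourRank-injective {α} {β} eq = just-injective (begin
      just α                               ≡⟨ sym (proj₂ (neighbourOf α)) ⟩
      colour P u (proj₁ (neighbourOf α))   ≡⟨ cong (colour P u) (rank-injective Used _ _ _ _ eq) ⟩
      colour P u (proj₁ (neighbourOf β))   ≡⟨ proj₂ (neighbourOf β) ⟩
      just β                               ∎)
      where open ≡-Reasoning
    Used⊆Adj : ∀ y → Used y ≡ true → Adj G u y ≡ true
    Used⊆Adj y c with colour P u y in eq
    ... | just _ = colour⇒adj P eq
    v-uncoloured : Used v ≡ false
    v-uncoloured rewrite uncoloured = refl
    fewer : count Used < r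
    fewer = subst (count Used <_) (trans (sym (degree≡count G u)) (regular u))
                  (count-mono-< Used (Adj G u) Used⊆Adj v v-uncoloured uv)

  partner : PartialColouring → Fin n → Fin r → Maybe (Fin n)
  partner P x γ with any? (λ y → colour P x y ≟ᴹ just γ)
  ... | yes (y , _) = just y
  ... | no _        = nothing

  partner-sound : ∀ P x γ {y} → partner P x γ ≡ just y → colour P x y ≡ just γ
  partner-sound P x γ eq with any? (λ y → colour P x y ≟ᴹ just γ)
  partner-sound P x γ refl | yes (_ , c) = c

  partner-complete : ∀ P x γ {y} → colour P x y ≡ just γ → partner P x γ ≡ just y
  partner-complete P x γ {y} c with any? (λ y → colour P x y ≟ᴹ just γ)
  ... | yes (y′ , c′) = cong just (proper P {x} c′ c)
  ... | no none       = ⊥-elim (none (y , c))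

  -- Swapping α and β along the maximal α/β-alternating walk from v frees α at v,
  -- and bipartiteness keeps u off that walk.
  module KempeSwap (P : PartialColouring) (side : Fin n → Bool)
                   (crossing : ∀ {x y} → Adj G x y ≡ true → side x ≢ side y)
                   {u v : Fin n} (uv : Adj G u v ≡ true) {α β : Fin r}
                   (u-misses : Misses P u α) (v-misses : Misses P v β) (α≢β : α ≢ β) where

    even : ℕ → Bool
    even zero    = true
    even (suc i) = not (even i)

    colourAt : ℕ → Fin r
    colourAt i = if even i then α else β

    walk : ℕ → Maybe (Fin n)
    walk zero    = just v
    walk (suc i) = walk i >>= λ x → partner P x (colourAt i)

    walk-pred : ∀ i {y} → walk (suc i) ≡ just y → ∃ λ x → walk i ≡ just x × colour P x y ≡ just (colourAt i)
    walk-pred i w with walk i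
    ... | just x = x , refl , partner-sound P x (colourAt i) w

    walk-step : ∀ i {x y} → walk i ≡ just x → colour P x y ≡ just (colourAt i) → walk (suc i) ≡ just y
    walk-step i {x} w c rewrite w = partner-complete P x (colourAt i) c

    sideAt : ℕ → Bool
    sideAt i = if even i then side v else not (side v)

    sideAt-suc : ∀ i → sideAt (suc i) ≡ not (sideAt i)
    sideAt-suc i with even i
    ... | true  = refl
    ... | false = sym (not-involutive (side v))

    walk-side : ∀ i {x} → walk i ≡ just x → side x ≡ sideAt i
    walk-side zero    refl = refl
    walk-side (suc i) w with walk-pred i w
    ... | x′ , w′ , c = begin
      side _          ≡⟨ ¬-not (≢-sym (crossing (colour⇒adj P c))) ⟩
      not (side x′)   ≡⟨ cong not (walk-side i w′) ⟩
      not (sideAt i)  ≡⟨ sym (sideAt-suc i) ⟩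
      sideAt (suc i)  ∎
      where open ≡-Reasoning

    sideAt-parity : ∀ i j → sideAt i ≡ sideAt j → even i ≡ even j
    sideAt-parity i j eq with even i | even j
    ... | true  | true  = refl
    ... | false | false = refl
    ... | true  | false = ⊥-elim (not-¬ refl eq)
    ... | false | true  = ⊥-elim (not-¬ refl (sym eq))

    walk-parity : ∀ i j {x} → walk i ≡ just x → walk j ≡ just x → even i ≡ even j
    walk-parity i j wi wj = sideAt-parity i j (trans (sym (walk-side i wi)) (walk-side j wj))

    walk-injective : ∀ i j {x} → walk i ≡ just x → walk j ≡ just x → i < j → ⊥
    walk-injective zero (suc j) w₀ wj _ with walk-pred j wj
    ... | x′ , _ , c = v-misses x′ (begin
      colour P v x′                     ≡⟨ colour-sym P v x′ ⟩
      colour P x′ v                     ≡⟨ cong (colour P x′) (just-injective w₀) ⟩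
      colour P x′ _                     ≡⟨ c ⟩
      just (if even j then α else β)    ≡⟨ cong (λ b → just (if b then α else β)) j-odd ⟩
      just β                            ∎)
      where
      open ≡-Reasoning
      j-odd : even j ≡ false
      j-odd = not-injective (sym (walk-parity zero (suc j) w₀ wj))
    walk-injective (suc i) (suc j) wi wj (s≤s i<j) with walk-pred i wi | walk-pred j wj
    ... | x₁ , w₁ , c₁ | x₂ , w₂ , c₂ = walk-injective i j w₁ (trans w₂ (cong just (sym x₁≡x₂))) i<j
      where
      sameColour : colourAt i ≡ colourAt j
      sameColour = cong (λ b → if b then α else β) (not-injective (walk-parity (suc i) (suc j) wi wj))
      x₁≡x₂ : x₁ ≡ x₂
      x₁≡x₂ = proper P (trans (colour-sym P _ x₁) (trans c₁ (cong just sameColour))) (trans (colour-sym P _ x₂) c₂)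

    walk-prefix : ∀ i k {y} → walk (k + i) ≡ just y → ∃ λ x → walk i ≡ just x
    walk-prefix i zero    w = _ , w
    walk-prefix i (suc k) w = walk-prefix i k (proj₁ (proj₂ (walk-pred (k + i) w)))

    walk-upTo : ∀ {z} → walk n ≡ just z → (q : Fin (suc n)) → ∃ λ x → walk (toℕ q) ≡ just x
    walk-upTo wn q = walk-prefix (toℕ q) (n ∸ toℕ q) (trans (cong walk (m∸n+n≡m (s≤s⁻¹ (toℕ<n q)))) wn)

    walk-ends : walk n ≡ nothing
    walk-ends with walk n in wn
    ... | nothing = refl
    ... | just z with pigeonhole (n<1+n n) (proj₁ ∘ walk-upTo wn)
    ...   | i , j , i<j , same = ⊥-elim (walk-injective (toℕ i) (toℕ j) (proj₂ (walk-upTo wn i))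
                                           (trans (proj₂ (walk-upTo wn j)) (cong just (sym same))) i<j)

    walk-ended : ∀ k → walk (k + n) ≡ nothing
    walk-ended zero = walk-ends
    walk-ended (suc k) rewrite walk-ended k = refl

    walk-bound : ∀ i {x} → walk i ≡ just x → i < n
    walk-bound i w with <-≤-connex i n
    ... | inj₁ i<n = i<n
    ... | inj₂ n≤i with trans (sym (walk-ended (i ∸ n))) (trans (cong walk (m∸n+n≡m n≤i)) w)
    ...   | ()

    OnWalk : Fin n → Set
    OnWalk x = ∃ λ i → walk i ≡ just x

    onWalk? : ∀ x → Dec (OnWalk x)
    onWalk? x with any? (λ (i : Fin n) → walk (toℕ i) ≟ᴹ just x)
    ... | yes (i , w) = yes (toℕ i , w)
    ... | no ¬w = no λ (i , w) → ¬w (fromℕ< (walk-bound i w) , trans (cong walk (toℕ-fromℕ< (walk-bound i w))) w)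

    IsAlternating : Fin r → Set
    IsAlternating γ = γ ≡ α ⊎ γ ≡ β

    otherColour : ∀ i {γ} → IsAlternating γ → γ ≢ colourAt (suc i) → γ ≡ colourAt i
    otherColour i γ-alt γ≢ with even i
    otherColour i (inj₁ refl) γ≢ | true  = refl
    otherColour i (inj₂ refl) γ≢ | true  = ⊥-elim (γ≢ refl)
    otherColour i (inj₁ refl) γ≢ | false = ⊥-elim (γ≢ refl)
    otherColour i (inj₂ refl) γ≢ | false = refl

    walk-closed : ∀ {x y γ} → OnWalk x → colour P x y ≡ just γ → IsAlternating γ → OnWalk y
    walk-closed {x} {y} {γ} (i , w) c γ-alt with γ ≟ colourAt i
    ... | yes refl = suc i , walk-step i w c
    walk-closed (zero , refl) c (inj₁ refl) | no γ≢ = ⊥-elim (γ≢ refl)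
    walk-closed (zero , refl) c (inj₂ refl) | no _  = ⊥-elim (v-misses _ c)
    walk-closed {x} {y} {γ} (suc i , w) c γ-alt | no γ≢ with walk-pred i w
    ... | x′ , w′ , c′ = i , trans w′ (cong just (proper P (trans (colour-sym P x x′) (trans c′ γ≡)) c))
      where
      γ≡ : just (colourAt i) ≡ just γ
      γ≡ = cong just (sym (otherColour i γ-alt γ≢))

    u-off-walk : ¬ OnWalk u
    u-off-walk (zero , w) = crossing uv (cong side (sym (just-injective w)))
    u-off-walk (suc i , w) with even i in ei | walk-pred i w
    ... | true  | x′ , _ , c = u-misses x′ (trans (colour-sym P u x′) c)
    ... | false | _ = crossing uv (trans (walk-side (suc i) w) (cong (λ b → if not b then side v else not (side v)) ei))

    swap : Fin r → Fin r
    swap γ with γ ≟ α | γ ≟ β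
    ... | yes _ | _     = β
    ... | no _  | yes _ = α
    ... | no _  | no _  = γ

    swap-α : swap α ≡ β
    swap-α with α ≟ α
    ... | yes _ = refl
    ... | no α≢α = ⊥-elim (α≢α refl)

    swap-β : swap β ≡ α
    swap-β with β ≟ α | β ≟ β
    ... | yes β≡α | _      = ⊥-elim (α≢β (sym β≡α))
    ... | no _    | yes _  = refl
    ... | no _    | no β≢β = ⊥-elim (β≢β refl)

    swap-fixes : ∀ {γ} → γ ≢ α → γ ≢ β → swap γ ≡ γ
    swap-fixes {γ} γ≢α γ≢β with γ ≟ α | γ ≟ β
    ... | yes γ≡α | _       = ⊥-elim (γ≢α γ≡α)
    ... | no _    | yes γ≡β = ⊥-elim (γ≢β γ≡β)
    ... | no _    | no _    = refl

    swap-involutive : ∀ γ → swap (swap γ) ≡ γ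
    swap-involutive γ = byCases (γ ≟ α) (γ ≟ β)
      where
      byCases : Dec (γ ≡ α) → Dec (γ ≡ β) → swap (swap γ) ≡ γ
      byCases (yes refl) _        = trans (cong swap swap-α) swap-β
      byCases (no _)     (yes refl) = trans (cong swap swap-β) swap-α
      byCases (no γ≢α)   (no γ≢β)   = trans (cong swap (swap-fixes γ≢α γ≢β)) (swap-fixes γ≢α γ≢β)

    map-swap⁻¹ : ∀ {m δ} → map swap m ≡ just δ → m ≡ just (swap δ)
    map-swap⁻¹ {just γ} refl = cong just (sym (swap-involutive γ))

    swap-off-chain : ∀ {x y} → OnWalk x → ¬ OnWalk y → map swap (colour P x y) ≡ colour P x y
    swap-off-chain {x} {y} on off with colour P x y in c
    ... | nothing = refl
    ... | just γ with γ ≟ α | γ ≟ β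
    ...   | yes γ≡α | _       = ⊥-elim (off (walk-closed on c (inj₁ γ≡α)))
    ...   | no _    | yes γ≡β = ⊥-elim (off (walk-closed on c (inj₂ γ≡β)))
    ...   | no _    | no _    = refl

    colour′ : Fin n → Fin n → Maybe (Fin r)
    colour′ x y with onWalk? x
    ... | yes _ = map swap (colour P x y)
    ... | no _  = colour P x y

    swapped : PartialColouring
    swapped = record { colour = colour′ ; colour⇒adj = adj′ ; colour-sym = sym′ ; proper = λ {x} → proper′ {x} }
      where
      adj′ : ∀ {x y δ} → colour′ x y ≡ just δ → Adj G x y ≡ true
      adj′ {x} c with onWalk? x
      ... | yes _ = colour⇒adj P (map-swap⁻¹ c)
      ... | no _  = colour⇒adj P c
      sym′ : ∀ x y → colour′ x y ≡ colour′ y x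
      sym′ x y with onWalk? x | onWalk? y
      ... | yes _  | yes _  = cong (map swap) (colour-sym P x y)
      ... | no _   | no _   = colour-sym P x y
      ... | yes on | no off = trans (swap-off-chain on off) (colour-sym P x y)
      ... | no off | yes on = trans (colour-sym P x y) (sym (swap-off-chain on off))
      proper′ : ∀ {x y z δ} → colour′ x y ≡ just δ → colour′ x z ≡ just δ → y ≡ z
      proper′ {x} c₁ c₂ with onWalk? x
      ... | yes _ = proper P {x} (map-swap⁻¹ c₁) (map-swap⁻¹ c₂)
      ... | no _  = proper P {x} c₁ c₂

    extends : P ⊑ swapped
    extends {x} c with onWalk? x
    ... | yes _ rewrite c = _ , refl
    ... | no _  = _ , c

    u-misses′ : Misses swapped u α
    u-misses′ y c with onWalk? u
    ... | yes on = u-off-walk on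
    ... | no _   = u-misses y c

    v-misses′ : Misses swapped v α
    v-misses′ y c with onWalk? v
    ... | yes _  = v-misses y (trans (map-swap⁻¹ c) (cong just swap-α))
    ... | no off = off (zero , refl)

  module _ (regular : Regular r G) (side : Fin n → Bool)
           (crossing : ∀ {x y} → Adj G x y ≡ true → side x ≢ side y) where

    colourUncoloured : (P : PartialColouring) {u v : Fin n} → Adj G u v ≡ true → colour P u v ≡ nothing →
                       Σ PartialColouring λ Q → P ⊑ Q × ∃ λ γ → colour Q u v ≡ just γ
    colourUncoloured P {u} {v} uv uncoloured
      with missingColour regular P uv uncoloured
         | missingColour regular P (adj-sym G uv) (trans (colour-sym P v u) uncoloured)
    ... | α , u-misses | β , v-misses with any? (λ y → colour P v y ≟ᴹ just α)
    ...   | no absent =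
      let Q , P⊑Q , c = colourEdge P α uv u-misses (λ y c → absent (y , c)) in Q , P⊑Q , α , c
    ...   | yes (y , c) =
      let Q , P′⊑Q , c′ = colourEdge swapped α uv u-misses′ v-misses′
      in Q , ⊑-trans {P} {swapped} {Q} extends P′⊑Q , α , c′
      where
      α≢β : α ≢ β
      α≢β refl = v-misses y c
      open KempeSwap P side crossing uv u-misses v-misses α≢β

    Coloured : PartialColouring → Fin n × Fin n → Set
    Coloured P (u , v) = Adj G u v ≡ true → ∃ λ γ → colour P u v ≡ just γ

    colourAll : (es : List (Fin n × Fin n)) (P : PartialColouring) →
                Σ PartialColouring λ Q → P ⊑ Q × (∀ {e} → e ∈ es → Coloured Q e)
    colourAll [] P = P , ⊑-refl {P} , λ ()
    colourAll ((u , v) ∷ es) P =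
      let Q , P⊑Q , uv-coloured = colourFirst
          R , Q⊑R , es-coloured = colourAll es Q
      in R , ⊑-trans {P} {Q} {R} P⊑Q Q⊑R , λ where
           (Any.here refl) uv → Q⊑R (proj₂ (uv-coloured uv))
           (Any.there e∈es) → es-coloured e∈es
      where
      colourFirst : Σ PartialColouring λ Q → P ⊑ Q × Coloured Q (u , v)
      colourFirst with Adj G u v in uv | colour P u v in c
      ... | false | _      = P , ⊑-refl {P} , λ ()
      ... | true  | just γ = P , ⊑-refl {P} , λ _ → γ , c
      ... | true  | nothing =
        let Q , P⊑Q , γc = colourUncoloured P uv c in Q , P⊑Q , λ _ → γc

    totalColouring : Σ PartialColouring λ P → ∀ u v → Adj G u v ≡ true → ∃ λ γ → colour P u v ≡ just γ
    totalColouring =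
      let P , _ , coloured = colourAll (cartesianProduct (allFin n) (allFin n)) emptyColouring
      in P , λ u v → coloured (∈-cartesianProduct⁺ (∈-allFin u) (∈-allFin v))

injective⇒surjective : ∀ {m r} (f : Fin m → Fin (suc r)) → (∀ {i j} → f i ≡ f j → i ≡ j) → m ≡ suc r →
                       ∀ γ → ∃ λ i → f i ≡ γ
injective⇒surjective {m} {r} f f-injective m≡ γ with any? (λ i → f i ≟ γ)
... | yes hit = hit
... | no miss = ⊥-elim (<-irrefl refl (subst (_≤ r) m≡ (injective⇒≤ punchOut-injective′)))
  where
  f≢γ : ∀ i → γ ≢ f i
  f≢γ i eq = miss (i , sym eq)
  punchOut-injective′ : ∀ {i j} → punchOut (f≢γ i) ≡ punchOut (f≢γ j) → i ≡ j
  punchOut-injective′ {i} {j} eq = f-injective (punchOut-injective (f≢γ i) (f≢γ j) eq)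

record OneFactorisation {n} (r : ℕ) (G : Graph n) : Set where
  field
    colour           : Fin n → Fin n → Fin r
    colour-sym       : ∀ {x y} → Adj G x y ≡ true → colour x y ≡ colour y x
    neighbour        : Fin n → Fin r → Fin n
    neighbour-adj    : ∀ x γ → Adj G x (neighbour x γ) ≡ true
    colour-neighbour : ∀ x γ → colour x (neighbour x γ) ≡ γ
    neighbour-colour : ∀ {x y} → Adj G x y ≡ true → neighbour x (colour x y) ≡ y

  neighbour-injective : ∀ x {γ δ} → neighbour x γ ≡ neighbour x δ → γ ≡ δ
  neighbour-injective x {γ} {δ} eq = trans (sym (colour-neighbour x γ)) (trans (cong (colour x) eq) (colour-neighbour x δ))

  neighbour-involutive : ∀ x γ → neighbour (neighbour x γ) γ ≡ x
  neighbour-involutive x γ = begin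
    neighbour y γ               ≡⟨ cong (neighbour y) (sym (colour-neighbour x γ)) ⟩
    neighbour y (colour x y)    ≡⟨ cong (neighbour y) (colour-sym (neighbour-adj x γ)) ⟩
    neighbour y (colour y x)    ≡⟨ neighbour-colour (adj-sym G (neighbour-adj x γ)) ⟩
    x                           ∎
    where
    open ≡-Reasoning
    y : Fin n
    y = neighbour x γ

regularBipartite⇒oneFactorisation : ∀ {n r} (G : Graph n) → Regular (suc r) G → Bipartite G →
                                    OneFactorisation (suc r) G
regularBipartite⇒oneFactorisation {n} {r} G regular (side , crossing) = record
  { colour = colour′ ; colour-sym = colour-sym′ ; neighbour = neighbour
  ; neighbour-adj = λ x γ → enum-true (Adj G x) _
  ; colour-neighbour = λ x γ → proj₂ (neighbourIndex x γ)
  ; neighbour-colour = λ {x} {y} xy → proper′ (enum-true (Adj G x) _) xy (proj₂ (neighbourIndex x (colour′ x y))) }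
  where
  open PartialColouring using () renaming (colour to colourᴾ; colour-sym to colourᴾ-sym; proper to properᴾ)
  P : PartialColouring G
  P = proj₁ (totalColouring G regular side λ {x} {y} → crossing x y)

  total : ∀ x y → Adj G x y ≡ true → ∃ λ γ → colourᴾ P x y ≡ just γ
  total = proj₂ (totalColouring G regular side λ {x} {y} → crossing x y)

  colour′ : Fin n → Fin n → Fin (suc r)
  colour′ x y = fromMaybe zero (colourᴾ P x y)

  colour≡ : ∀ {x y} → Adj G x y ≡ true → colourᴾ P x y ≡ just (colour′ x y)
  colour≡ {x} {y} xy with total x y xy
  ... | _ , c rewrite c = refl

  colour-sym′ : ∀ {x y} → Adj G x y ≡ true → colour′ x y ≡ colour′ y x
  colour-sym′ {x} {y} _ = cong (fromMaybe zero) (colourᴾ-sym P x y)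

  proper′ : ∀ {x y z} → Adj G x y ≡ true → Adj G x z ≡ true → colour′ x y ≡ colour′ x z → y ≡ z
  proper′ {x} xy xz eq = properᴾ P {x} (colour≡ xy) (trans (colour≡ xz) (cong just (sym eq)))

  -- Each colour occurs at x: the neighbours of x, r + 1 of them, receive distinct colours.
  neighbourIndex : ∀ x γ → ∃ λ i → colour′ x (enum (Adj G x) i) ≡ γ
  neighbourIndex x = injective⇒surjective (colour′ x ∘ enum (Adj G x))
    (λ eq → enum-injective (Adj G x) _ _ (proper′ (enum-true (Adj G x) _) (enum-true (Adj G x) _) eq))
    (trans (sym (degree≡count G x)) (regular x))

  neighbour : Fin n → Fin (suc r) → Fin n
  neighbour x γ = enum (Adj G x) (proj₁ (neighbourIndex x γ))

-- Double-stars

_==_ : ∀ {p} → Fin p → Fin p → Bool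
x == y = does (x ≟ y)

==⇒≡ : ∀ {p} {x y : Fin p} → (x == y) ≡ true → x ≡ y
==⇒≡ {x = x} {y} eq with x ≟ y
... | yes x≡y = x≡y

count-== : ∀ {p} (c : Fin p) → count (_== c) ≡ 1
count-== {suc p} zero    = cong suc (count-false p)
count-== {suc p} (suc c) = count-== c

Reachable-closed : ∀ {p} (S : Graph p) (X : Fin p → Set) → (∀ {u v} → X u → Adj S u v ≡ true → X v) →
                   ∀ {a b} → X a → Reachable S a b → X b
Reachable-closed S X closed Xa here          = Xa
Reachable-closed S X closed Xa (step uv rest) = Reachable-closed S X closed (closed Xa uv) rest

data Place {p} (c₁ c₂ : Fin p) (Leaf₁ Leaf₂ : Fin p → Bool) (x : Fin p) : Set where
  centre₁ : x ≡ c₁ → Place c₁ c₂ Leaf₁ Leaf₂ x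
  centre₂ : x ≡ c₂ → Place c₁ c₂ Leaf₁ Leaf₂ x
  leaf₁   : Leaf₁ x ≡ true → Place c₁ c₂ Leaf₁ Leaf₂ x
  leaf₂   : Leaf₂ x ≡ true → Place c₁ c₂ Leaf₁ Leaf₂ x

data DirectedEdge {p} (c₁ c₂ : Fin p) (Leaf₁ Leaf₂ : Fin p → Bool) (x y : Fin p) : Set where
  centre : x ≡ c₁ → y ≡ c₂ → DirectedEdge c₁ c₂ Leaf₁ Leaf₂ x y
  spoke₁ : x ≡ c₁ → Leaf₁ y ≡ true → DirectedEdge c₁ c₂ Leaf₁ Leaf₂ x y
  spoke₂ : x ≡ c₂ → Leaf₂ y ≡ true → DirectedEdge c₁ c₂ Leaf₁ Leaf₂ x y

LeafOf : ∀ {p} → Graph p → Fin p → Fin p → Fin p → Bool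
LeafOf S c c′ x = Adj S c x ∧ not (x == c′)

LeafOf-intro : ∀ {p} (S : Graph p) {c c′ x} → Adj S c x ≡ true → x ≢ c′ → LeafOf S c c′ x ≡ true
LeafOf-intro S {c′ = c′} {x} cx x≢c′ rewrite cx | dec-false (x ≟ c′) x≢c′ = refl

LeafOf-adj : ∀ {p} (S : Graph p) {c c′ x} → LeafOf S c c′ x ≡ true → Adj S c x ≡ true
LeafOf-adj S = ∧-conicalˡ _ _

LeafOf-≢ : ∀ {p} (S : Graph p) {c c′ x} → LeafOf S c c′ x ≡ true → x ≢ c′
LeafOf-≢ S {c′ = c′} {x} l refl with trans (sym (cong not (dec-true (c′ ≟ c′) refl))) (∧-conicalʳ _ _ l)
... | ()

record DoubleStarShape {p} (S : Graph p) : Set where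
  field
    c₁ c₂ : Fin p
    c₁≢c₂ : c₁ ≢ c₂
    c₁c₂  : Adj S c₁ c₂ ≡ true

  Leaf₁ : Fin p → Bool
  Leaf₁ = LeafOf S c₁ c₂

  Leaf₂ : Fin p → Bool
  Leaf₂ = LeafOf S c₂ c₁

  field
    place         : ∀ x → Place c₁ c₂ Leaf₁ Leaf₂ x
    leaf₁-pendant : ∀ {x y} → Leaf₁ x ≡ true → Adj S x y ≡ true → y ≡ c₁
    leaf₂-pendant : ∀ {x y} → Leaf₂ x ≡ true → Adj S x y ≡ true → y ≡ c₂

  leaf₁-adj : ∀ {x} → Leaf₁ x ≡ true → Adj S c₁ x ≡ true
  leaf₁-adj = LeafOf-adj S

  leaf₂-adj : ∀ {x} → Leaf₂ x ≡ true → Adj S c₂ x ≡ true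
  leaf₂-adj = LeafOf-adj S

  ¬leaf₁-c₁ : Leaf₁ c₁ ≡ true → ⊥
  ¬leaf₁-c₁ l = adj⇒≢ S (leaf₁-adj l) refl

  ¬leaf₂-c₂ : Leaf₂ c₂ ≡ true → ⊥
  ¬leaf₂-c₂ l = adj⇒≢ S (leaf₂-adj l) refl

  ¬leaf₁-c₂ : Leaf₁ c₂ ≡ true → ⊥
  ¬leaf₁-c₂ l = LeafOf-≢ S l refl

  ¬leaf₂-c₁ : Leaf₂ c₁ ≡ true → ⊥
  ¬leaf₂-c₁ l = LeafOf-≢ S l refl

  ¬leaf₁×leaf₂ : ∀ {x} → Leaf₁ x ≡ true → Leaf₂ x ≡ true → ⊥
  ¬leaf₁×leaf₂ l₁ l₂ = c₁≢c₂ (sym (leaf₁-pendant l₁ (adj-sym S (leaf₂-adj l₂))))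

  directed : ∀ {x y} → Adj S x y ≡ true →
             DirectedEdge c₁ c₂ Leaf₁ Leaf₂ x y ⊎ DirectedEdge c₁ c₂ Leaf₁ Leaf₂ y x
  directed {x} {y} xy with place x
  ... | leaf₁ l = inj₂ (spoke₁ (leaf₁-pendant l xy) l)
  ... | leaf₂ l = inj₂ (spoke₂ (leaf₂-pendant l xy) l)
  ... | centre₁ refl with y ≟ c₂
  ...   | yes y≡c₂ = inj₁ (centre refl y≡c₂)
  ...   | no y≢c₂  = inj₁ (spoke₁ refl (LeafOf-intro S xy y≢c₂))
  directed {x} {y} xy | centre₂ refl with y ≟ c₁
  ...   | yes y≡c₁ = inj₂ (centre y≡c₁ refl)
  ...   | no y≢c₁  = inj₁ (spoke₂ refl (LeafOf-intro S xy y≢c₁))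

  place-unique : ∀ {x} (q q′ : Place c₁ c₂ Leaf₁ Leaf₂ x) → q ≡ q′
  place-unique (centre₁ refl) (centre₁ refl) = refl
  place-unique (centre₂ refl) (centre₂ refl) = refl
  place-unique (leaf₁ l)      (leaf₁ l′)     = cong leaf₁ (Decidable⇒UIP.≡-irrelevant _≟ᵇ_ l l′)
  place-unique (leaf₂ l)      (leaf₂ l′)     = cong leaf₂ (Decidable⇒UIP.≡-irrelevant _≟ᵇ_ l l′)
  place-unique (centre₁ refl) (centre₂ e)    = ⊥-elim (c₁≢c₂ e)
  place-unique (centre₂ refl) (centre₁ e)    = ⊥-elim (c₁≢c₂ (sym e))
  place-unique (centre₁ refl) (leaf₁ l)      = ⊥-elim (¬leaf₁-c₁ l)
  place-unique (centre₁ refl) (leaf₂ l)      = ⊥-elim (¬leaf₂-c₁ l)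
  place-unique (centre₂ refl) (leaf₁ l)      = ⊥-elim (¬leaf₁-c₂ l)
  place-unique (centre₂ refl) (leaf₂ l)      = ⊥-elim (¬leaf₂-c₂ l)
  place-unique (leaf₁ l)      (centre₁ refl) = ⊥-elim (¬leaf₁-c₁ l)
  place-unique (leaf₂ l)      (centre₁ refl) = ⊥-elim (¬leaf₂-c₁ l)
  place-unique (leaf₁ l)      (centre₂ refl) = ⊥-elim (¬leaf₁-c₂ l)
  place-unique (leaf₂ l)      (centre₂ refl) = ⊥-elim (¬leaf₂-c₂ l)
  place-unique (leaf₁ l₁)     (leaf₂ l₂)     = ⊥-elim (¬leaf₁×leaf₂ l₁ l₂)
  place-unique (leaf₂ l₂)     (leaf₁ l₁)     = ⊥-elim (¬leaf₁×leaf₂ l₁ l₂)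

∨≡true⁻ : ∀ a b → a ∨ b ≡ true → a ≡ true ⊎ b ≡ true
∨≡true⁻ true  b _ = inj₁ refl
∨≡true⁻ false b e = inj₂ e

∨≡true⁺ : ∀ a b c d → a ≡ true ⊎ b ≡ true ⊎ c ≡ true ⊎ d ≡ true → a ∨ (b ∨ (c ∨ d)) ≡ true
∨≡true⁺ true  _     _     _    _ = refl
∨≡true⁺ false true  _     _    _ = refl
∨≡true⁺ false false true  _    _ = refl
∨≡true⁺ false false false true _ = refl
∨≡true⁺ false false false false (inj₁ ())
∨≡true⁺ false false false false (inj₂ (inj₁ ()))
∨≡true⁺ false false false false (inj₂ (inj₂ (inj₁ ())))
∨≡true⁺ false false false false (inj₂ (inj₂ (inj₂ ())))

module _ {p} {S : Graph p} (D : DoubleStarShape S) where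
  open DoubleStarShape D

  vertexCount : p ≡ 2 + (count Leaf₁ + count Leaf₂)
  vertexCount = begin
    p
      ≡⟨ sym (count-true p) ⟩
    count {p} (λ _ → true)
      ≡⟨ count-cong _ _ (λ x → sym (placed x)) ⟩
    count (λ x → (x == c₁) ∨ ((x == c₂) ∨ Leaf x))
      ≡⟨ count-∨ _ _ apart₁ ⟩
    count (_== c₁) + count (λ x → (x == c₂) ∨ Leaf x)
      ≡⟨ cong₂ _+_ (count-== c₁) (count-∨ _ _ apart₂) ⟩
    1 + (count (_== c₂) + count Leaf)
      ≡⟨ cong (λ m → 1 + (m + count Leaf)) (count-== c₂) ⟩
    2 + count Leaf
      ≡⟨ cong (2 +_) (count-∨ Leaf₁ Leaf₂ (λ _ → ¬leaf₁×leaf₂)) ⟩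
    2 + (count Leaf₁ + count Leaf₂)
      ∎
    where
    open ≡-Reasoning
    Leaf : Fin p → Bool
    Leaf x = Leaf₁ x ∨ Leaf₂ x
    placed : ∀ x → (x == c₁) ∨ ((x == c₂) ∨ (Leaf₁ x ∨ Leaf₂ x)) ≡ true
    placed x = ∨≡true⁺ (x == c₁) (x == c₂) (Leaf₁ x) (Leaf₂ x) (which (place x))
      where
      which : Place c₁ c₂ Leaf₁ Leaf₂ x →
              (x == c₁) ≡ true ⊎ (x == c₂) ≡ true ⊎ Leaf₁ x ≡ true ⊎ Leaf₂ x ≡ true
      which (centre₁ refl) = inj₁ (dec-true (c₁ ≟ c₁) refl)
      which (centre₂ refl) = inj₂ (inj₁ (dec-true (c₂ ≟ c₂) refl))
      which (leaf₁ l)      = inj₂ (inj₂ (inj₁ l))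
      which (leaf₂ l)      = inj₂ (inj₂ (inj₂ l))
    apart₁ : ∀ x → (x == c₁) ≡ true → (x == c₂) ∨ (Leaf₁ x ∨ Leaf₂ x) ≡ true → ⊥
    apart₁ x e rest with ==⇒≡ {x = x} e
    ... | refl = [ c₁≢c₂ ∘ ==⇒≡ , [ ¬leaf₁-c₁ , ¬leaf₂-c₁ ]′ ∘ ∨≡true⁻ _ _ ]′
                   (∨≡true⁻ _ _ rest)
    apart₂ : ∀ x → (x == c₂) ≡ true → Leaf₁ x ∨ Leaf₂ x ≡ true → ⊥
    apart₂ x e rest with ==⇒≡ {x = x} e
    ... | refl = [ ¬leaf₁-c₂ , ¬leaf₂-c₂ ]′ (∨≡true⁻ _ _ rest)

  size≡ : IsTree S → size S ≡ suc (count Leaf₁ + count Leaf₂)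
  size≡ (_ , p≡size+1) = cong ℕ.pred (trans (+-comm 1 (size S)) (trans (sym p≡size+1) vertexCount))

NonPendant : ∀ {p} → Graph p → Fin p → Bool
NonPendant S v = does (¬? (degree S v ℕ.≟ 1))

module FromCentres {p} (S : Graph p) (connected : Connected S) {c₁ c₂ : Fin p} (c₁≢c₂ : c₁ ≢ c₂)
                   (onlyCentres : ∀ z → NonPendant S z ≡ true → z ≡ c₁ ⊎ z ≡ c₂) where

  pendant-unique : ∀ {z y y′} → z ≢ c₁ → z ≢ c₂ → Adj S z y ≡ true → Adj S z y′ ≡ true → y ≡ y′
  pendant-unique {z} z≢c₁ z≢c₂ = count≡1⇒unique (Adj S z) degree≡1 _ _
    where
    degree≡1 : count (Adj S z) ≡ 1
    degree≡1 with degree S z ℕ.≟ 1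
    ... | yes d≡1 = trans (sym (degree≡count S z)) d≡1
    ... | no d≢1  = ⊥-elim ([ z≢c₁ , z≢c₂ ]′ (onlyCentres z (dec-true (¬? (degree S z ℕ.≟ 1)) d≢1)))

  -- Otherwise c₁ and its neighbours, all pendant, would form a component without c₂.
  c₁c₂ : Adj S c₁ c₂ ≡ true
  c₁c₂ with Adj S c₁ c₂ in e
  ... | true  = refl
  ... | false = ⊥-elim (unreached (Reachable-closed S Star closed (inj₁ refl) (connected c₁ c₂)))
    where
    Star : Fin p → Set
    Star w = w ≡ c₁ ⊎ (w ≢ c₂ × Adj S c₁ w ≡ true)
    closed : ∀ {u v} → Star u → Adj S u v ≡ true → Star v
    closed {v = v} (inj₁ refl) uv with v ≟ c₂
    ... | no v≢c₂ = inj₂ (v≢c₂ , uv)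
    ... | yes refl with trans (sym uv) e
    ...   | ()
    closed (inj₂ (u≢c₂ , c₁u)) uv = inj₁ (pendant-unique (adj⇒≢ S c₁u ∘ sym) u≢c₂ uv (adj-sym S c₁u))
    unreached : ¬ Star c₂
    unreached (inj₁ c₂≡c₁)       = c₁≢c₂ (sym c₂≡c₁)
    unreached (inj₂ (c₂≢c₂ , _)) = c₂≢c₂ refl

  leaf₁-pendant : ∀ {x y} → LeafOf S c₁ c₂ x ≡ true → Adj S x y ≡ true → y ≡ c₁
  leaf₁-pendant l xy = pendant-unique (adj⇒≢ S (LeafOf-adj S l) ∘ sym) (LeafOf-≢ S l) xy (adj-sym S (LeafOf-adj S l))

  leaf₂-pendant : ∀ {x y} → LeafOf S c₂ c₁ x ≡ true → Adj S x y ≡ true → y ≡ c₂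
  leaf₂-pendant l xy = pendant-unique (LeafOf-≢ S l) (adj⇒≢ S (LeafOf-adj S l) ∘ sym) xy (adj-sym S (LeafOf-adj S l))

  Place′ : Fin p → Set
  Place′ = Place c₁ c₂ (LeafOf S c₁ c₂) (LeafOf S c₂ c₁)

  place-closed : ∀ {u v} → Place′ u → Adj S u v ≡ true → Place′ v
  place-closed {v = v} (centre₁ refl) uv with v ≟ c₂
  ... | yes v≡c₂ = centre₂ v≡c₂
  ... | no v≢c₂  = leaf₁ (LeafOf-intro S uv v≢c₂)
  place-closed {v = v} (centre₂ refl) uv with v ≟ c₁
  ... | yes v≡c₁ = centre₁ v≡c₁
  ... | no v≢c₁  = leaf₂ (LeafOf-intro S uv v≢c₁)
  place-closed (leaf₁ l) uv = centre₁ (leaf₁-pendant l uv)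
  place-closed (leaf₂ l) uv = centre₂ (leaf₂-pendant l uv)

  shape : DoubleStarShape S
  shape = record
    { c₁ = c₁ ; c₂ = c₂ ; c₁≢c₂ = c₁≢c₂ ; c₁c₂ = c₁c₂
    ; place = λ x → Reachable-closed S Place′ place-closed (centre₁ refl) (connected c₁ x)
    ; leaf₁-pendant = leaf₁-pendant ; leaf₂-pendant = leaf₂-pendant }

doubleStarShape : ∀ {p} (S : Graph p) → IsDoubleStar S → DoubleStarShape S
doubleStarShape {p} S ((connected , _) , twoNonPendant)
  with count≡2⇒pair (NonPendant S) (trans (sym (length-filter≡count {p} (λ x → x) _)) twoNonPendant)
... | _ , _ , c₁≢c₂ , _ , _ , onlyCentres = FromCentres.shape S connected c₁≢c₂ onlyCentres

-- Copies of a double-star in a 1-factorised bipartite graph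

data Role (a b : ℕ) : Set where
  centreEdge : Role a b
  leafEdge₁  : Fin a → Role a b
  leafEdge₂  : Fin b → Role a b

leafEdge₁-injective : ∀ {a b} {i j : Fin a} → leafEdge₁ {b = b} i ≡ leafEdge₁ j → i ≡ j
leafEdge₁-injective refl = refl

leafEdge₂-injective : ∀ {a b} {i j : Fin b} → leafEdge₂ {a} i ≡ leafEdge₂ j → i ≡ j
leafEdge₂-injective refl = refl

module Sides {n r} {G : Graph n} (F : OneFactorisation r G) (side : Fin n → Bool)
         (crossing : ∀ {x y} → Adj G x y ≡ true → side x ≢ side y) where
  open OneFactorisation F

  side-adj : ∀ {x y} → Adj G x y ≡ true → side y ≡ not (side x)
  side-adj xy = ¬-not (crossing xy ∘ sym)

  side-neighbour : ∀ x γ → side (neighbour x γ) ≡ not (side x)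
  side-neighbour x γ = side-adj (neighbour-adj x γ)

  -- The vertex of side A at which the copy containing the edge x y (x on side A) is
  -- centred, if that edge plays role ρ in its copy and hub is the copy's centre colour.
  anchor : ∀ {a b} → Fin r → Role a b → Fin n → Fin n → Fin n
  anchor hub centreEdge    x y = x
  anchor hub (leafEdge₁ _) x y = x
  anchor hub (leafEdge₂ _) x y = neighbour y hub

  anchor-side : ∀ {a b} hub (ρ : Role a b) {x y} → side x ≡ true → Adj G x y ≡ true →
                side (anchor hub ρ x y) ≡ true
  anchor-side hub centreEdge    x-side _  = x-side
  anchor-side hub (leafEdge₁ _) x-side _  = x-side
  anchor-side hub (leafEdge₂ _) x-side xy =
    trans (side-neighbour _ hub) (cong not (trans (side-adj xy) (cong not x-side)))

  -- The copy of S at a vertex w on side A: the centre edge w w₂ gets colour hub, the leaf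
  -- edges of c₁ hang off w and those of c₂ off w₂, each in the colour hue assigns to its role.
  module Embedding {p} {S : Graph p} (D : DoubleStarShape S)
                   (hue : Role (count (DoubleStarShape.Leaf₁ D)) (count (DoubleStarShape.Leaf₂ D)) → Fin r)
                   (hue-injective : ∀ {ρ σ} → hue ρ ≡ hue σ → ρ ≡ σ)
                   (w : Fin n) (w-side : side w ≡ true) where
    open DoubleStarShape D

    Role′ : Set
    Role′ = Role (count Leaf₁) (count Leaf₂)

    hub : Fin r
    hub = hue centreEdge

    w₂ : Fin n
    w₂ = neighbour w hub

    InClass : Fin n → Fin n → Set
    InClass x y = ∃ λ ρ → colour x y ≡ hue ρ × anchor hub ρ x y ≡ w

    Place′ : Fin p → Set
    Place′ = Place c₁ c₂ Leaf₁ Leaf₂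

    -- Each image is reached from w (nearW) or from w₂ along the edge of its role; c₁ is reached
    -- from w₂ along the centre edge.
    nearW : ∀ {x} → Place′ x → Bool
    nearW (centre₁ _) = false
    nearW (centre₂ _) = true
    nearW (leaf₁ _)   = true
    nearW (leaf₂ _)   = false

    edgeRole : ∀ {x} → Place′ x → Role′
    edgeRole (centre₁ _)     = centreEdge
    edgeRole (centre₂ _)     = centreEdge
    edgeRole {x} (leaf₁ l)   = leafEdge₁ (rank Leaf₁ x l)
    edgeRole {x} (leaf₂ l)   = leafEdge₂ (rank Leaf₂ x l)

    base : ∀ {x} → Place′ x → Fin n
    base q = if nearW q then w else w₂

    embedAt : ∀ {x} → Place′ x → Fin n
    embedAt q = neighbour (base q) (hue (edgeRole q))

    embed : Fin p → Fin n
    embed x = embedAt (place x)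

    embed-place : ∀ {x} (q : Place′ x) → embed x ≡ embedAt q
    embed-place q = cong embedAt (place-unique (place _) q)

    side-base : ∀ {x} (q : Place′ x) → side (base q) ≡ nearW q
    side-base (centre₁ _) = trans (side-neighbour w hub) (cong not w-side)
    side-base (centre₂ _) = w-side
    side-base (leaf₁ _)   = w-side
    side-base (leaf₂ _)   = trans (side-neighbour w hub) (cong not w-side)

    side-embedAt : ∀ {x} (q : Place′ x) → side (embedAt q) ≡ not (nearW q)
    side-embedAt q = trans (side-neighbour (base q) _) (cong not (side-base q))

    place-determined : ∀ {x x′} (q : Place′ x) (q′ : Place′ x′) →
                       nearW q ≡ nearW q′ → edgeRole q ≡ edgeRole q′ → x ≡ x′
    place-determined (centre₁ refl) (centre₁ refl) _ _  = refl
    place-determined (centre₂ refl) (centre₂ refl) _ _  = refl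
    place-determined (leaf₁ l)      (leaf₁ l′)     _ eq = rank-injective Leaf₁ _ _ l l′ (leafEdge₁-injective eq)
    place-determined (leaf₂ l)      (leaf₂ l′)     _ eq = rank-injective Leaf₂ _ _ l l′ (leafEdge₂-injective eq)
    place-determined (centre₁ _)    (centre₂ _)    () _
    place-determined (centre₁ _)    (leaf₁ _)      () _
    place-determined (centre₁ _)    (leaf₂ _)      _ ()
    place-determined (centre₂ _)    (centre₁ _)    () _
    place-determined (centre₂ _)    (leaf₁ _)      _ ()
    place-determined (centre₂ _)    (leaf₂ _)      () _
    place-determined (leaf₁ _)      (centre₁ _)    () _
    place-determined (leaf₁ _)      (centre₂ _)    _ ()
    place-determined (leaf₁ _)      (leaf₂ _)      () _
    place-determined (leaf₂ _)      (centre₁ _)    _ ()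
    place-determined (leaf₂ _)      (centre₂ _)    () _
    place-determined (leaf₂ _)      (leaf₁ _)      () _

    embedAt-injective : ∀ {x x′} (q : Place′ x) (q′ : Place′ x′) → embedAt q ≡ embedAt q′ → x ≡ x′
    embedAt-injective q q′ eq = place-determined q q′ sameSide (hue-injective (neighbour-injective (base q) sameHue))
      where
      sameSide : nearW q ≡ nearW q′
      sameSide = not-injective (trans (sym (side-embedAt q)) (trans (cong side eq) (side-embedAt q′)))
      sameHue : neighbour (base q) (hue (edgeRole q)) ≡ neighbour (base q) (hue (edgeRole q′))
      sameHue = trans eq (cong (λ b → neighbour (if b then w else w₂) (hue (edgeRole q′))) (sym sameSide))

    embed-injective : ∀ {x x′} → embed x ≡ embed x′ → x ≡ x′
    embed-injective = embedAt-injective (place _) (place _)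

    embed-c₁ : embed c₁ ≡ w
    embed-c₁ = trans (embed-place (centre₁ refl)) (neighbour-involutive w hub)

    embed-c₂ : embed c₂ ≡ w₂
    embed-c₂ = embed-place (centre₂ refl)

    embed-leaf₁ : ∀ {x} (l : Leaf₁ x ≡ true) → embed x ≡ neighbour w (hue (leafEdge₁ (rank Leaf₁ x l)))
    embed-leaf₁ l = embed-place (leaf₁ l)

    embed-leaf₂ : ∀ {x} (l : Leaf₂ x ≡ true) → embed x ≡ neighbour w₂ (hue (leafEdge₂ (rank Leaf₂ x l)))
    embed-leaf₂ l = embed-place (leaf₂ l)

    embed-enum₁ : ∀ ρ → embed (enum Leaf₁ ρ) ≡ neighbour w (hue (leafEdge₁ ρ))
    embed-enum₁ ρ =
      trans (embed-leaf₁ (enum-true Leaf₁ ρ)) (cong (neighbour w ∘ hue ∘ leafEdge₁) (rank-enum Leaf₁ ρ _))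

    embed-enum₂ : ∀ σ → embed (enum Leaf₂ σ) ≡ neighbour w₂ (hue (leafEdge₂ σ))
    embed-enum₂ σ =
      trans (embed-leaf₂ (enum-true Leaf₂ σ)) (cong (neighbour w₂ ∘ hue ∘ leafEdge₂) (rank-enum Leaf₂ σ _))

    colour-neighbourᵒ : ∀ x γ → colour (neighbour x γ) x ≡ γ
    colour-neighbourᵒ x γ = trans (colour-sym (adj-sym G (neighbour-adj x γ))) (colour-neighbour x γ)

    ImageEdge : Fin n → Fin n → Set
    ImageEdge x y = Σ (Fin p) λ a → Σ (Fin p) λ b → Adj S a b ≡ true × embed a ≡ x × embed b ≡ y

    inClass⇒image : ∀ {x y} → Adj G x y ≡ true → InClass x y → ImageEdge x y
    inClass⇒image {x} {y} xy (centreEdge , xy-hub , refl) =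
      c₁ , c₂ , c₁c₂ , embed-c₁ , trans embed-c₂ (trans (cong (neighbour x) (sym xy-hub)) (neighbour-colour xy))
    inClass⇒image {x} {y} xy (leafEdge₁ ρ , xy-hue , refl) =
      c₁ , enum Leaf₁ ρ , leaf₁-adj (enum-true Leaf₁ ρ) , embed-c₁ ,
      trans (embed-enum₁ ρ) (trans (cong (neighbour x) (sym xy-hue)) (neighbour-colour xy))
    inClass⇒image {x} {y} xy (leafEdge₂ σ , xy-hue , y-anchored) =
      enum Leaf₂ σ , c₂ , adj-sym S (leaf₂-adj (enum-true Leaf₂ σ)) , x-image , trans embed-c₂ (sym y≡w₂)
      where
      y≡w₂ : y ≡ w₂
      y≡w₂ = trans (sym (neighbour-involutive y hub)) (cong (λ z → neighbour z hub) y-anchored)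
      x-image : embed (enum Leaf₂ σ) ≡ x
      x-image = begin
        embed (enum Leaf₂ σ)              ≡⟨ embed-enum₂ σ ⟩
        neighbour w₂ (hue (leafEdge₂ σ))  ≡⟨ cong (λ z → neighbour z (hue (leafEdge₂ σ))) (sym y≡w₂) ⟩
        neighbour y (hue (leafEdge₂ σ))   ≡⟨ cong (neighbour y) (trans (sym xy-hue) (colour-sym xy)) ⟩
        neighbour y (colour y x)          ≡⟨ neighbour-colour (adj-sym G xy) ⟩
        x                                 ∎
        where open ≡-Reasoning

    module Class {m} (lab : Fin n → Fin n → Fin m) (lab-sym : ∀ {x y} → Adj G x y ≡ true → lab x y ≡ lab y x)
                 (i : Fin m)
                 (lab⇒inClass : ∀ {x y} → side x ≡ true → Adj G x y ≡ true → lab x y ≡ i → InClass x y)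
                 (inClass⇒lab : ∀ {x y} → side x ≡ true → InClass x y → lab x y ≡ i) where

      InLabel : Fin n → Fin n → Set
      InLabel x y = Adj G x y ≡ true × lab x y ≡ i

      flip : ∀ {x y} → InLabel x y → InLabel y x
      flip (xy , l) = adj-sym G xy , trans (sym (lab-sym xy)) l

      inLabel⇒image : ∀ {x y} → InLabel x y → ImageEdge x y
      inLabel⇒image {x} {y} (xy , l) with side x in sx
      ... | true  = inClass⇒image xy (lab⇒inClass sx xy l)
      ... | false with inClass⇒image (adj-sym G xy) (lab⇒inClass y-side (adj-sym G xy) (trans (sym (lab-sym xy)) l))
        where
        y-side : side y ≡ true
        y-side = trans (side-adj xy) (cong not sx)
      ...   | a , b , ab , ea , eb = b , a , adj-sym S ab , eb , ea

      directed⇒inLabel : ∀ {a b} → DirectedEdge c₁ c₂ Leaf₁ Leaf₂ a b → InLabel (embed a) (embed b)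
      directed⇒inLabel (centre refl refl) rewrite embed-c₁ | embed-c₂ =
        neighbour-adj w hub , inClass⇒lab w-side (centreEdge , colour-neighbour w hub , refl)
      directed⇒inLabel {b = b} (spoke₁ refl l) rewrite embed-c₁ | embed-leaf₁ l =
        neighbour-adj w _ , inClass⇒lab w-side (leafEdge₁ _ , colour-neighbour w _ , refl)
      directed⇒inLabel {b = b} (spoke₂ refl l) rewrite embed-c₂ | embed-leaf₂ l =
        flip (adj-sym G (neighbour-adj w₂ _) ,
              inClass⇒lab leaf-side (leafEdge₂ _ , colour-neighbourᵒ w₂ _ , neighbour-involutive w hub))
        where
        leaf-side : side (neighbour w₂ (hue (leafEdge₂ (rank Leaf₂ b l)))) ≡ true
        leaf-side = trans (side-neighbour w₂ _) (cong not (trans (side-neighbour w hub) (cong not w-side)))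

      classIso : ClassIso G lab i S
      classIso = embed , embed-injective , (λ a b → mk⇔ (sound a b) (complete a b)) , covered
        where
        sound : ∀ a b → Adj S a b ≡ true → InLabel (embed a) (embed b)
        sound a b ab with directed ab
        ... | inj₁ d = directed⇒inLabel d
        ... | inj₂ d = flip (directed⇒inLabel d)
        complete : ∀ a b → InLabel (embed a) (embed b) → Adj S a b ≡ true
        complete a b e with inLabel⇒image e
        ... | a′ , b′ , a′b′ , ea , eb rewrite embed-injective ea | embed-injective eb = a′b′
        covered : ∀ u v → Adj G u v ≡ true → lab u v ≡ i →
                  (∃ λ a → embed a ≡ u) × (∃ λ b → embed b ≡ v)
        covered u v uv l with inLabel⇒image (uv , l)
        ... | a , b , _ , ea , eb = (a , ea) , (b , eb)

-- Decomposition into double-stars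

∑ : ∀ {m} → (Fin m → ℕ) → ℕ
∑ {zero}  f = 0
∑ {suc m} f = f zero + ∑ (f ∘ suc)

∑-cong : ∀ {m} {f g : Fin m → ℕ} → (∀ i → f i ≡ g i) → ∑ f ≡ ∑ g
∑-cong {zero}  eq = refl
∑-cong {suc m} eq = cong₂ _+_ (eq zero) (∑-cong (eq ∘ suc))

flatten : ∀ {m} (f : Fin m → ℕ) → Σ (Fin m) (Fin ∘ f) → Fin (∑ f)
flatten f (zero  , j) = j ↑ˡ ∑ (f ∘ suc)
flatten f (suc g , j) = f zero ↑ʳ flatten (f ∘ suc) (g , j)

unflatten : ∀ {m} (f : Fin m → ℕ) → Fin (∑ f) → Σ (Fin m) (Fin ∘ f)
unflatten {suc m} f i with splitAt (f zero) i
... | inj₁ j  = zero , j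
... | inj₂ i′ = let g , j = unflatten (f ∘ suc) i′ in suc g , j

unflatten-flatten : ∀ {m} (f : Fin m → ℕ) c → unflatten f (flatten f c) ≡ c
unflatten-flatten f (zero , j) rewrite splitAt-↑ˡ (f zero) j (∑ (f ∘ suc)) = refl
unflatten-flatten f (suc g , j)
  rewrite splitAt-↑ʳ (f zero) (∑ (f ∘ suc)) (flatten (f ∘ suc) (g , j))
        | unflatten-flatten (f ∘ suc) (g , j) = refl

flatten-unflatten : ∀ {m} (f : Fin m → ℕ) i → flatten f (unflatten f i) ≡ i
flatten-unflatten {suc m} f i with splitAt (f zero) i in eq
... | inj₁ j  = splitAt⁻¹-↑ˡ eq
... | inj₂ i′ = trans (cong (f zero ↑ʳ_) (flatten-unflatten (f ∘ suc) i′)) (splitAt⁻¹-↑ʳ eq)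

roleAt : ∀ {a b} → Fin (suc (a + b)) → Role a b
roleAt         zero    = centreEdge
roleAt {a} {b} (suc o) = [ leafEdge₁ , leafEdge₂ ]′ (splitAt a o)

roleIndex : ∀ {a b} → Role a b → Fin (suc (a + b))
roleIndex         centreEdge    = zero
roleIndex {a} {b} (leafEdge₁ i) = suc (i ↑ˡ b)
roleIndex {a} {b} (leafEdge₂ j) = suc (a ↑ʳ j)

roleAt-roleIndex : ∀ {a b} (ρ : Role a b) → roleAt (roleIndex ρ) ≡ ρ
roleAt-roleIndex         centreEdge    = refl
roleAt-roleIndex {a} {b} (leafEdge₁ i) rewrite splitAt-↑ˡ a i b = refl
roleAt-roleIndex {a} {b} (leafEdge₂ j) rewrite splitAt-↑ʳ a b j = refl

roleIndex-roleAt : ∀ {a b} (o : Fin (suc (a + b))) → roleIndex {a} {b} (roleAt o) ≡ o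
roleIndex-roleAt         zero    = refl
roleIndex-roleAt {a} {b} (suc o) with splitAt a o in eq
... | inj₁ i = cong suc (splitAt⁻¹-↑ˡ eq)
... | inj₂ j = cong suc (splitAt⁻¹-↑ʳ eq)

Decomposable : ∀ {n m} {p : Fin m → ℕ} → Graph n → ((g : Fin m) → Graph (p g)) → Set
Decomposable {n} G S =
  Σ ℕ λ c → Σ (Fin n → Fin n → Fin c) λ lab →
    (∀ u v → Adj G u v ≡ true → lab u v ≡ lab v u) × (∀ i → ∃ λ g → ClassIso G lab i (S g))

module Assembly {n} {G : Graph n} (side : Fin n → Bool)
                (crossing : ∀ {x y} → Adj G x y ≡ true → side x ≢ side y)
                {m} {p : Fin m → ℕ} {S : (g : Fin m) → Graph (p g)} (D : ∀ g → DoubleStarShape (S g)) where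

  leaves₁ leaves₂ : Fin m → ℕ
  leaves₁ g = count (DoubleStarShape.Leaf₁ (D g))
  leaves₂ g = count (DoubleStarShape.Leaf₂ (D g))

  -- Colour block g gives each edge of S g its own colour.
  Slot : Set
  Slot = Σ (Fin m) λ g → Role (leaves₁ g) (leaves₂ g)

  edgeCount : Fin m → ℕ
  edgeCount g = suc (leaves₁ g + leaves₂ g)

  R : ℕ
  R = ∑ edgeCount

  slot : Fin R → Slot
  slot γ = map₂ roleAt (unflatten edgeCount γ)

  hueOf : Slot → Fin R
  hueOf (g , ρ) = flatten edgeCount (g , roleIndex ρ)

  slot-hueOf : ∀ s → slot (hueOf s) ≡ s
  slot-hueOf (g , ρ) rewrite unflatten-flatten edgeCount (g , roleIndex ρ) =
    cong (g ,_) (roleAt-roleIndex ρ)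

  hueOf-slot : ∀ γ → hueOf (slot γ) ≡ γ
  hueOf-slot γ = trans (cong (λ o → flatten edgeCount (proj₁ u , o)) (roleIndex-roleAt (proj₂ u)))
                       (flatten-unflatten edgeCount γ)
    where
    u : Σ (Fin m) (Fin ∘ edgeCount)
    u = unflatten edgeCount γ

  hueOf-injective : ∀ g {ρ σ} → hueOf (g , ρ) ≡ hueOf (g , σ) → ρ ≡ σ
  hueOf-injective g eq =
    ,-injectiveʳ-UIP (Decidable⇒UIP.≡-irrelevant _≟_)
                     (trans (sym (slot-hueOf _)) (trans (cong slot eq) (slot-hueOf _)))

  -- γ₀ is an arbitrary colour, used to move vertices of side B to side A.
  module Labelling (F : OneFactorisation R G) (γ₀ : Fin R) where
    open OneFactorisation F
    open Sides F side crossing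

    toA : Fin n → Fin n
    toA z = if side z then z else neighbour z γ₀

    toA-side : ∀ z → side (toA z) ≡ true
    toA-side z with side z in e
    ... | true  = e
    ... | false = trans (side-neighbour z γ₀) (cong not e)

    toA-fixed : ∀ {z} → side z ≡ true → toA z ≡ z
    toA-fixed z-side rewrite z-side = refl

    rankA : Fin n → Fin (count side)
    rankA z = rank side (toA z) (toA-side z)

    rankA-enum : ∀ ρ → rankA (enum side ρ) ≡ ρ
    rankA-enum ρ = enum-injective side _ _ (trans (enum-rank side _ _) (toA-fixed (enum-true side ρ)))

    rankA⇒enum : ∀ {z ρ} → side z ≡ true → rankA z ≡ ρ → z ≡ enum side ρ
    rankA⇒enum {z} z-side eq =
      trans (sym (toA-fixed z-side)) (trans (sym (enum-rank side (toA z) _)) (cong (enum side) eq))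

    anchorOf : Slot → Fin n → Fin n → Fin n
    anchorOf (g , ρ) = anchor (hueOf (g , centreEdge)) ρ

    -- An edge x y with x on side A is labelled by its block and the anchor of its copy.
    labelOf : Slot → Fin n → Fin n → Fin (m * count side)
    labelOf s x y = combine (proj₁ s) (rankA (anchorOf s x y))

    lab : Fin n → Fin n → Fin (m * count side)
    lab u v = if side u then labelOf (slot (colour u v)) u v else labelOf (slot (colour v u)) v u

    lab-A : ∀ {x y} → side x ≡ true → lab x y ≡ labelOf (slot (colour x y)) x y
    lab-A x-side rewrite x-side = refl

    lab-sym : ∀ {u v} → Adj G u v ≡ true → lab u v ≡ lab v u
    lab-sym {u} {v} uv with side u in su | side v in sv
    ... | true  | false = refl
    ... | false | true  = refl
    ... | true  | true  = ⊥-elim (crossing uv (trans su (sym sv)))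
    ... | false | false = ⊥-elim (crossing uv (trans su (sym sv)))

    classAt : ∀ i → ∃ λ g → ClassIso G lab i (S g)
    classAt i = g , Class.classIso lab lab-sym i lab⇒inClass inClass⇒lab
      where
      g : Fin m
      g = proj₁ (remQuot {m} (count side) i)
      ρA : Fin (count side)
      ρA = proj₂ (remQuot {m} (count side) i)
      i≡ : combine g ρA ≡ i
      i≡ = combine-remQuot {m} (count side) i
      open Embedding (D g) (λ ρ → hueOf (g , ρ)) (hueOf-injective g) (enum side ρA) (enum-true side ρA)

      lab⇒inClass : ∀ {x y} → side x ≡ true → Adj G x y ≡ true → lab x y ≡ i → InClass x y
      lab⇒inClass {x} {y} x-side xy l =
        fromSlot (slot (colour x y)) refl (trans (sym (lab-A x-side)) (trans l (sym i≡)))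
        where
        fromSlot : ∀ s → slot (colour x y) ≡ s → labelOf s x y ≡ combine g ρA → InClass x y
        fromSlot (g′ , ρ) es eq with combine-injective g′ _ g ρA eq
        ... | refl , rank≡ =
          ρ , trans (sym (hueOf-slot _)) (cong hueOf es) , rankA⇒enum (anchor-side _ ρ x-side xy) rank≡

      inClass⇒lab : ∀ {x y} → side x ≡ true → InClass x y → lab x y ≡ i
      inClass⇒lab {x} {y} x-side (ρ , colour≡ , anchor≡) = begin
        lab x y                                      ≡⟨ lab-A x-side ⟩
        labelOf (slot (colour x y)) x y              ≡⟨ cong (λ c → labelOf (slot c) x y) colour≡ ⟩
        labelOf (slot (hueOf (g , ρ))) x y           ≡⟨ cong (λ s → labelOf s x y) (slot-hueOf (g , ρ)) ⟩
        combine g (rankA (anchorOf (g , ρ) x y))     ≡⟨ cong (combine g ∘ rankA) anchor≡ ⟩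
        combine g (rankA (enum side ρA))             ≡⟨ cong (combine g) (rankA-enum ρA) ⟩
        combine g ρA                                 ≡⟨ i≡ ⟩
        i                                            ∎
        where open ≡-Reasoning

regularBipartite⇒decomposable : ∀ {n m} {p : Fin (suc m) → ℕ} (S : (g : Fin (suc m)) → Graph (p g)) →
                                (∀ g → IsDoubleStar (S g)) → (G : Graph n) →
                                Regular (∑ (size ∘ S)) G → Bipartite G → Decomposable G S
regularBipartite⇒decomposable S isDoubleStar G regular (side , crossing) =
  _ , lab , (λ u v → lab-sym) , classAt
  where
  D : ∀ g → DoubleStarShape (S g)
  D g = doubleStarShape (S g) (isDoubleStar g)
  open Assembly side (λ {x} {y} → crossing x y) D
  degree≡ : ∑ (size ∘ S) ≡ R
  degree≡ = ∑-cong (λ g → size≡ (D g) (proj₁ (isDoubleStar g)))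
  open Labelling (regularBipartite⇒oneFactorisation G (subst (λ d → Regular d G) degree≡ regular) (side , crossing)) zero

∑-const : ∀ k c → ∑ {k} (λ _ → c) ≡ k * c
∑-const zero    c = refl
∑-const (suc k) c = cong (c +_) (∑-const k c)

module Family₂ {p q} (S₁ : Graph p) (S₂ : Graph q) (k : ℕ) where

  vertexCounts : Fin (suc k) → ℕ
  vertexCounts zero    = q
  vertexCounts (suc _) = p

  family : (g : Fin (suc k)) → Graph (vertexCounts g)
  family zero    = S₂
  family (suc _) = S₁

  family-size : ∑ (size ∘ family) ≡ size S₂ + k * size S₁
  family-size = cong (size S₂ +_) (∑-const k (size S₁))

  family⇒Decomposable₂ : ∀ {n} {G : Graph n} → Decomposable G family → Decomposable₂ G S₁ S₂
  family⇒Decomposable₂ {G = G} (c , lab , lab-sym , classes) = c , lab , lab-sym , oneOfTwo ∘ classes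
    where
    oneOfTwo : ∀ {i} → ∃ (λ g → ClassIso G lab i (family g)) → ClassIso G lab i S₁ ⊎ ClassIso G lab i S₂
    oneOfTwo (zero  , iso) = inj₂ iso
    oneOfTwo (suc _ , iso) = inj₁ iso

mainTheorem2 : (r s k t : ℕ) → 1 ≤ k → r ≡ s * k + t → 3 ≤ r → 3 ≤ s → 3 ≤ t →
               ∀ {p q} (S₁ : Graph p) (S₂ : Graph q) →
               IsDoubleStar S₁ → size S₁ ≡ s → IsDoubleStar S₂ → size S₂ ≡ t →
               ∀ {n} (G : Graph n) → Regular r G → Bipartite G →
               Decomposable₂ G S₁ S₂
mainTheorem2 r s k t _ r≡ _ _ _ S₁ S₂ isDS₁ size₁ isDS₂ size₂ G regular bipartite =
  family⇒Decomposable₂ {G = G}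
    (regularBipartite⇒decomposable family isDoubleStar G (subst (λ d → Regular d G) degree≡ regular) bipartite)
  where
  open Family₂ S₁ S₂ k
  isDoubleStar : ∀ g → IsDoubleStar (family g)
  isDoubleStar zero    = isDS₂
  isDoubleStar (suc _) = isDS₁
  degree≡ : r ≡ ∑ (size ∘ family)
  degree≡ = begin
    r                       ≡⟨ r≡ ⟩
    s * k + t               ≡⟨ +-comm (s * k) t ⟩
    t + s * k               ≡⟨ cong₂ _+_ (sym size₂) (trans (*-comm s k) (cong (k *_) (sym size₁))) ⟩
    size S₂ + k * size S₁   ≡⟨ sym family-size ⟩
    ∑ (size ∘ family)       ∎
    where open ≡-Reasoning
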